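{- For each $n\in\mathbb N$ let $\mathcal P_n=(C_1,\dots,C_{m_n})$ be an ordered partition of $\{0,1\}^n$, and let $B_n$ be a colour class $C\in\mathcal P_n$ for which the number of parts $|\mathrm{SP}(C)|$ is maximal among all colour classes of $\mathcal P_n$. Assume: (1) every $v\in\{0,1\}^n$ occurs in at least one colour class $C_i$ of $\mathcal P_n$; (2) $\max_{i\in[m_n]}|C_i|\in\mathcal O(n)$; (3) $|\mathrm{SP}(B_n)|\in o(n)$. Then the orbit size $|\mathrm{Orbit}_n(\mathcal P_n)|$ of $\mathcal P_n$ with respect to the action of $\mathrm{Sym}_n$ on $\{0,1\}^n$ grows faster than any polynomial in $2^n$.
   Context: $[n]=\{1,\dots,n\}$, $\mathrm{Sym}_n$ the symmetric group on $[n]$, acting on $\{0,1\}^n$ by $\pi(v)=v_{\pi^{ -1}(1)}\cdots v_{\pi^{ -1}(n)}$, elementwise on sets and componentwise on tuples; $\mathrm{Stab}_n(x)=\{\pi\in\mathrm{Sym}_n:\pi(x)=x\}$ and $\mathrm{Orbit}_n(x)=\{\pi(x):\pi\in\mathrm{Sym}_n\}$. An ordered partition of $\{0,1\}^n$ is a tuple of pairwise disjoint nonempty sets (colour classes) with union $\{0,1\}^n$. For a partition $\mathcal Q$ of $[n]$, its pointwise stabiliser is $\{\pi\in\mathrm{Sym}_n:\pi(Q)=Q\ \forall Q\in\mathcal Q\}$. A supporting partition of a group $G\le\mathrm{Sym}_n$ is a partition of $[n]$ whose pointwise stabiliser is a subgroup of $G$; every $G$ has a unique coarsest supporting partition $\mathrm{SP}(G)$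 (every supporting partition of $G$ refines it). For $C\subseteq\{0,1\}^n$, $\mathrm{SP}(C):=\mathrm{SP}(\mathrm{Stab}_n(C))$, and $|\mathrm{SP}(C)|$ is its number of parts. -}

module Defs where

open import Data.Nat using (ℕ; zero; suc; _+_; _*_; _^_; _≤_; _<_)
open import Data.Bool using (Bool; true; false; if_then_else_)
open import Data.Fin using (Fin)
open import Data.Vec using (Vec; []; _∷_; lookup; tabulate)
open import Data.List using (List; [_]; map; _++_)
open import Data.Nat.ListAction using (sum)
open import Data.Product using (Σ; ∃; _×_)
open import Data.Fin.Permutation using (Permutation′; _⟨$⟩ʳ_; _⟨$⟩ˡ_)
open import Relation.Binary.PropositionalEquality using (_≡_; _≢_)

Word : ℕ → Set
Word n = Vec Bool n

Sym : ℕ → Set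
Sym n = Permutation′ n

act : ∀ {n} → Sym n → Word n → Word n
act π v = tabulate (λ i → lookup v (π ⟨$⟩ˡ i))

Colour : ℕ → Set
Colour n = Word n → Bool

_∈C_ : ∀ {n} → Word n → Colour n → Set
v ∈C C = C v ≡ true

-- π(C) = { π(v) : v ∈ C },  i.e.  w ∈ π(C) iff π⁻¹(w) ∈ C
actSet : ∀ {n} → Sym n → Colour n → Colour n
actSet π C w = C (tabulate (λ i → lookup w (π ⟨$⟩ʳ i)))

SameSet : ∀ {n} → Colour n → Colour n → Set
SameSet C D = ∀ w → C w ≡ D w

allWords : (n : ℕ) → List (Word n)
allWords zero = [ [] ]
allWords (suc n) = map (false ∷_) (allWords n) ++ map (true ∷_) (allWords n)

card : ∀ {n} → Colour n → ℕ
card {n} C = sum (map (λ v → if C v then 1 else 0) (allWords n))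

IsOrderedPartition : ∀ {n m} → (Fin m → Colour n) → Set
IsOrderedPartition {n} {m} P =
  (∀ (i j : Fin m) → i ≢ j → ∀ v → v ∈C P i → P j v ≡ false)
  × (∀ (i : Fin m) → ∃ λ (v : Word n) → v ∈C P i)
  × (∀ (v : Word n) → ∃ λ (i : Fin m) → v ∈C P i)

actTuple : ∀ {n m} → Sym n → (Fin m → Colour n) → (Fin m → Colour n)
actTuple π P i = actSet π (P i)

SameTuple : ∀ {n m} → (Fin m → Colour n) → (Fin m → Colour n) → Set
SameTuple P Q = ∀ i → SameSet (P i) (Q i)

-- |Orbit_n(P)| = N : an enumeration g of the orbit without repetitions
OrbitSize : ∀ {n m} → (Fin m → Colour n) → ℕ → Set
OrbitSize {n} P N =
  Σ (Fin N → Sym n) λ g →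
    (∀ a b → SameTuple (actTuple (g a) P) (actTuple (g b) P) → a ≡ b)
    × (∀ (σ : Sym n) → ∃ λ a → SameTuple (actTuple σ P) (actTuple (g a) P))

Stab : ∀ {n} → Colour n → Sym n → Set
Stab C π = SameSet (actSet π C) C

-- a partition of [n] into exactly k (nonempty) parts: a surjective labelling
Surjective : ∀ {n k} → (Fin n → Fin k) → Set
Surjective {n} {k} f = ∀ (y : Fin k) → ∃ λ (x : Fin n) → f x ≡ y

PointwiseStab : ∀ {n k} → (Fin n → Fin k) → Sym n → Set
PointwiseStab f π = ∀ i → f (π ⟨$⟩ʳ i) ≡ f i

Supporting : ∀ {n k} → (Fin n → Fin k) → (Sym n → Set) → Set
Supporting {n} f G = ∀ (π : Sym n) → PointwiseStab f π → G π

IsSP : ∀ {n k} → (Fin n → Fin k) → (Sym n → Set) → Set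
IsSP {n} f G =
  Surjective f × Supporting f G
  × (∀ (k' : ℕ) (g : Fin n → Fin k') → Surjective g → Supporting g G →
       ∀ i j → g i ≡ g j → f i ≡ f j)

SPSize : ∀ {n} → Colour n → ℕ → Set
SPSize {n} C k = Σ (Fin n → Fin k) λ f → IsSP f (Stab C)

-- Choose s with n ≤ 2^s < 2n and let wⱼ ∈ {0,1}^n (j < s) carry at position x the j-th binary
-- digit of x; a permutation is then determined by its action on w₁ … w_s.  Let wⱼ lie in the
-- colour class C_{iⱼ}, and for each orbit element fix a representative g with g(𝒫) = σ(𝒫).
-- Then g⁻¹σ(wⱼ) ∈ g⁻¹σ(C_{iⱼ}) = C_{iⱼ}, so σ ↦ (σ(𝒫), g⁻¹σ(w₁), …, g⁻¹σ(w_s)) is an injection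
-- of Sym_n into a set of size |Orbit(𝒫)| · (cn)^s.  Hence n! ≤ |Orbit(𝒫)| · 2^{O(log² n)}, while
-- n! ≥ 2^{(e+2)n - O(1)}, so the orbit size eventually exceeds every c' · (2^n)^e.
module Submission where

open import Defs
open import Level using (0ℓ)
open import Data.Nat using (ℕ; zero; suc; _+_; _*_; _^_; _≤_; _<_; _!; z≤n; s≤s; NonZero; >-nonZero)
open import Data.Nat.Properties
open import Data.Nat.Logarithm using (⌊log₂⌋-mono-≤; ⌊log₂[2^n]⌋≡n)
open import Data.Nat.Tactic.RingSolver using (solve-∀)
open import Data.Nat.ListAction using (sum)
open import Data.Bool using (Bool; true; false; if_then_else_)
open import Data.Bool.Properties using () renaming (_≟_ to _≟ᵇ_)
open import Data.Empty using (⊥-elim)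
open import Data.Fin using (Fin; zero; suc; punchIn; inject≤; funToFin; finToFun; combine)
open import Data.Fin.Properties using (injective⇒≤; punchIn-injective; inject≤-injective; funToFin-finToFin; 2↔Bool)
open import Data.Fin.Permutation using (_⟨$⟩ʳ_; _⟨$⟩ˡ_; _≈_; id; flip; insert; insert-punchIn; inverseˡ; inverseʳ)
open import Data.Vec using (Vec; []; _∷_; lookup; tabulate)
open import Data.Vec.Properties using (lookup∘tabulate; tabulate∘lookup; tabulate-cong)
open import Data.List as List
  using (List; []; _∷_; [_]; length; map; filter; allFin; cartesianProductWith; cartesianProduct)
open import Data.List.Properties using (length-++; length-map; length-tabulate)
open import Data.List.Membership.Propositional using (_∈_)
open import Data.List.Membership.Propositional.Properties
  using (∈-lookup; ∈-map⁺; ∈-map⁻; ∈-++⁺ˡ; ∈-++⁺ʳ; ∈-filter⁺; ∈-allFin; ∈-cartesianProductWith⁺; ∈-cartesianProduct⁺)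
open import Data.List.Relation.Binary.Subset.Propositional using (_⊆_)
open import Data.List.Relation.Unary.Any as Any using (here)
open import Data.List.Relation.Unary.Any.Properties using (lookup-index)
open import Data.List.Relation.Unary.All as All using ([])
open import Data.List.Relation.Unary.AllPairs using ([]; _∷_)
open import Data.List.Relation.Unary.Unique.Propositional using (Unique)
import Data.List.Relation.Unary.Unique.Setoid as SetoidUnique
import Data.List.Relation.Unary.Unique.Setoid.Properties as SetoidUnique
open import Data.List.Relation.Unary.Unique.Propositional.Properties using (allFin⁺)
open import Data.Product using (∃; _×_; _,_; proj₁; proj₂)
open import Function using (_∘_; Inverse; Injection)
open import Function.Properties.Inverse using (↔⇒↣)
open import Relation.Binary.Bundles using (Setoid)
open import Relation.Binary.PropositionalEquality
  using (_≡_; _≗_; refl; sym; trans; cong; cong₂; subst; subst₂; setoid; module ≡-Reasoning)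
open import Relation.Nullary using (yes; no)

private variable
  A B C : Set

Unique⇒lookup-injective : ∀ {xs : List A} {i j} → Unique xs → List.lookup xs i ≡ List.lookup xs j → i ≡ j
Unique⇒lookup-injective {xs = _ ∷ _} {zero}  {zero}  _         _  = refl
Unique⇒lookup-injective {xs = _ ∷ _} {zero}  {suc j} (x∉ ∷ _)  eq = ⊥-elim (All.lookup x∉ (∈-lookup j) eq)
Unique⇒lookup-injective {xs = _ ∷ _} {suc i} {zero}  (x∉ ∷ _)  eq = ⊥-elim (All.lookup x∉ (∈-lookup i) (sym eq))
Unique⇒lookup-injective {xs = _ ∷ _} {suc i} {suc j} (_ ∷ xs!) eq = cong suc (Unique⇒lookup-injective xs! eq)

Unique-⊆⇒length≤ : ∀ {xs ys : List A} → Unique xs → xs ⊆ ys → length xs ≤ length ys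
Unique-⊆⇒length≤ {xs = xs} {ys} xs! xs⊆ys = injective⇒≤ position-injective
  where
  position : Fin (length xs) → Fin (length ys)
  position i = Any.index (xs⊆ys (∈-lookup i))
  position-injective : ∀ {i j} → position i ≡ position j → i ≡ j
  position-injective {i} {j} eq = Unique⇒lookup-injective xs! (begin
    List.lookup xs i            ≡⟨ lookup-index (xs⊆ys (∈-lookup i)) ⟩
    List.lookup ys (position i) ≡⟨ cong (List.lookup ys) eq ⟩
    List.lookup ys (position j) ≡⟨ lookup-index (xs⊆ys (∈-lookup j)) ⟨
    List.lookup xs j            ∎)
    where open ≡-Reasoning

length-cartesianProductWith : ∀ (f : A → B → C) xs ys →
  length (cartesianProductWith f xs ys) ≡ length xs * length ys
length-cartesianProductWith f []       ys = refl
length-cartesianProductWith f (x ∷ xs) ys = begin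
  length (map (f x) ys List.++ cartesianProductWith f xs ys)    ≡⟨ length-++ (map (f x) ys) ⟩
  length (map (f x) ys) + length (cartesianProductWith f xs ys)
    ≡⟨ cong₂ _+_ (length-map (f x) ys) (length-cartesianProductWith f xs ys) ⟩
  length ys + length xs * length ys                             ∎
  where open ≡-Reasoning

choices : ∀ {s} → (Fin s → List A) → List (Vec A s)
choices {s = zero}  L = [ [] ]
choices {s = suc s} L = cartesianProductWith _∷_ (L zero) (choices (L ∘ suc))

∈-choices : ∀ {s} (L : Fin s → List A) {x : Vec A s} → (∀ j → lookup x j ∈ L j) → x ∈ choices L
∈-choices {s = zero}  L {[]}    _  = here refl
∈-choices {s = suc s} L {a ∷ x} x∈ = ∈-cartesianProductWith⁺ _∷_ (x∈ zero) (∈-choices (L ∘ suc) (x∈ ∘ suc))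

length-choices≤ : ∀ {s} (L : Fin s → List A) {B} → (∀ j → length (L j) ≤ B) → length (choices L) ≤ B ^ s
length-choices≤ {s = zero}  L _    = ≤-refl
length-choices≤ {s = suc s} L len≤ = begin
  length (choices L)                           ≡⟨ length-cartesianProductWith _∷_ (L zero) (choices (L ∘ suc)) ⟩
  length (L zero) * length (choices (L ∘ suc)) ≤⟨ *-mono-≤ (len≤ zero) (length-choices≤ (L ∘ suc) (len≤ ∘ suc)) ⟩
  _                                            ∎
  where open ≤-Reasoning

≈-setoid : ℕ → Setoid 0ℓ 0ℓ
≈-setoid n = record
  { Carrier       = Sym n
  ; _≈_           = _≈_
  ; isEquivalence = record
    { refl  = λ _ → refl
    ; sym   = λ π≈ρ i → sym (π≈ρ i)
    ; trans = λ π≈ρ ρ≈σ i → trans (π≈ρ i) (ρ≈σ i)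
    }
  }

perms : ∀ n → List (Sym n)
perms zero    = [ id ]
perms (suc n) = cartesianProductWith (insert zero) (allFin (suc n)) (perms n)

length-perms : ∀ n → length (perms n) ≡ n !
length-perms zero    = refl
length-perms (suc n) = begin
  length (perms (suc n))                      ≡⟨ length-cartesianProductWith (insert zero) (allFin (suc n)) (perms n) ⟩
  length (allFin (suc n)) * length (perms n)  ≡⟨ cong₂ _*_ (length-tabulate {n = suc n} (λ i → i)) (length-perms n) ⟩
  suc n !                                     ∎
  where open ≡-Reasoning

insert-zero-injective : ∀ {n} {i j : Fin (suc n)} {π ρ : Sym n} →
  insert zero i π ≈ insert zero j ρ → i ≡ j × π ≈ ρ
insert-zero-injective {i = i} {j} {π} {ρ} eq = eq zero , λ k → punchIn-injective i _ _ (begin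
  punchIn i (π ⟨$⟩ʳ k)         ≡⟨ insert-punchIn zero i π k ⟨
  insert zero i π ⟨$⟩ʳ suc k   ≡⟨ eq (suc k) ⟩
  insert zero j ρ ⟨$⟩ʳ suc k   ≡⟨ insert-punchIn zero j ρ k ⟩
  punchIn j (ρ ⟨$⟩ʳ k)         ≡⟨ cong (λ l → punchIn l (ρ ⟨$⟩ʳ k)) (eq zero) ⟨
  punchIn i (ρ ⟨$⟩ʳ k)         ∎)
  where open ≡-Reasoning

perms-unique : ∀ n → SetoidUnique.Unique (≈-setoid n) (perms n)
perms-unique zero    = [] ∷ []
perms-unique (suc n) = SetoidUnique.cartesianProductWith⁺ (setoid (Fin (suc n))) (≈-setoid n) (≈-setoid (suc n))
  (insert zero) insert-zero-injective (allFin⁺ (suc n)) (perms-unique n)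

∈-allWords : ∀ {n} (w : Word n) → w ∈ allWords n
∈-allWords []                  = here refl
∈-allWords {suc n} (false ∷ w) = ∈-++⁺ˡ (∈-map⁺ (false ∷_) (∈-allWords w))
∈-allWords {suc n} (true ∷ w)  = ∈-++⁺ʳ (map (false ∷_) (allWords n)) (∈-map⁺ (true ∷_) (∈-allWords w))

members : ∀ {n} → Colour n → List (Word n)
members {n} C = filter (λ w → C w ≟ᵇ true) (allWords n)

∈-members : ∀ {n} (C : Colour n) {w} → w ∈C C → w ∈ members C
∈-members C {w} = ∈-filter⁺ (λ w → C w ≟ᵇ true) (∈-allWords w)

length-members : ∀ {n} (C : Colour n) → length (members C) ≡ card C
length-members {n} C = go (allWords n)
  where
  go : ∀ ws → length (filter (λ w → C w ≟ᵇ true) ws) ≡ sum (map (λ w → if C w then 1 else 0) ws)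
  go []       = refl
  go (w ∷ ws) with C w
  ... | true  = cong suc (go ws)
  ... | false = go ws

funToFin-cong : ∀ {m n} {f g : Fin m → Fin n} → f ≗ g → funToFin f ≡ funToFin g
funToFin-cong {zero}  _   = refl
funToFin-cong {suc m} f≗g = cong₂ combine (f≗g zero) (funToFin-cong (f≗g ∘ suc))

finToFun-injective : ∀ {m n} {i j : Fin (m ^ n)} → finToFun {m} {n} i ≗ finToFun j → i ≡ j
finToFun-injective {m} {n} {i} {j} eq = begin
  i                              ≡⟨ funToFin-finToFin {n} {m} i ⟨
  funToFin {n} {m} (finToFun i)  ≡⟨ funToFin-cong {n} {m} eq ⟩
  funToFin {n} {m} (finToFun j)  ≡⟨ funToFin-finToFin {n} {m} j ⟩
  j                              ∎
  where open ≡-Reasoning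

binaryCode : ∀ {n s} → n ≤ 2 ^ s → Fin n → Fin s → Bool
binaryCode n≤2^s x = Inverse.to 2↔Bool ∘ finToFun (inject≤ x n≤2^s)

binaryCode-injective : ∀ {n s} (n≤2^s : n ≤ 2 ^ s) {x y} → binaryCode n≤2^s x ≗ binaryCode n≤2^s y → x ≡ y
binaryCode-injective {s = s} n≤2^s eq = inject≤-injective n≤2^s n≤2^s _ _
  (finToFun-injective {2} {s} (Injection.injective (↔⇒↣ 2↔Bool) ∘ eq))

lookup-act : ∀ {n} (π : Sym n) (w : Word n) i → lookup (act π w) i ≡ lookup w (π ⟨$⟩ˡ i)
lookup-act π w i = lookup∘tabulate _ i

act-flip-act : ∀ {n} (π : Sym n) (w : Word n) → act (flip π) (act π w) ≡ w
act-flip-act π w = begin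
  tabulate (λ i → lookup (act π w) (π ⟨$⟩ʳ i))
    ≡⟨ tabulate-cong (λ i → trans (lookup-act π w _) (cong (lookup w) (inverseˡ π))) ⟩
  tabulate (lookup w)
    ≡⟨ tabulate∘lookup w ⟩
  w ∎
  where open ≡-Reasoning

act-act-flip : ∀ {n} (π : Sym n) (w : Word n) → act π (act (flip π) w) ≡ w
act-act-flip π = act-flip-act (flip π)

actSet-act : ∀ {n} (π : Sym n) (C : Colour n) (w : Word n) → actSet π C (act π w) ≡ C w
actSet-act π C w = cong C (act-flip-act π w)

⟨$⟩ˡ-cong⇒≈ : ∀ {n} {σ τ : Sym n} → (∀ i → σ ⟨$⟩ˡ i ≡ τ ⟨$⟩ˡ i) → σ ≈ τ
⟨$⟩ˡ-cong⇒≈ {σ = σ} {τ} eq x = begin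
  σ ⟨$⟩ʳ x                    ≡⟨ cong (σ ⟨$⟩ʳ_) (trans (eq (τ ⟨$⟩ʳ x)) (inverseˡ τ)) ⟨
  σ ⟨$⟩ʳ (σ ⟨$⟩ˡ (τ ⟨$⟩ʳ x))  ≡⟨ inverseʳ σ ⟩
  τ ⟨$⟩ʳ x                    ∎
  where open ≡-Reasoning

column : ∀ {n s} → (Fin n → Fin s → Bool) → Fin s → Word n
column code j = tabulate (λ x → code x j)

act-columns-injective : ∀ {n s} (code : Fin n → Fin s → Bool) → (∀ {x y} → code x ≗ code y → x ≡ y) →
  ∀ {σ τ : Sym n} → (∀ j → act σ (column code j) ≡ act τ (column code j)) → σ ≈ τ
act-columns-injective code code-injective {σ} {τ} eq = ⟨$⟩ˡ-cong⇒≈ {σ = σ} {τ} λ i → code-injective λ j → begin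
  code (σ ⟨$⟩ˡ i) j                 ≡⟨ lookup∘tabulate (λ x → code x j) (σ ⟨$⟩ˡ i) ⟨
  lookup (column code j) (σ ⟨$⟩ˡ i) ≡⟨ lookup-act σ (column code j) i ⟨
  lookup (act σ (column code j)) i  ≡⟨ cong (λ w → lookup w i) (eq j) ⟩
  lookup (act τ (column code j)) i  ≡⟨ lookup-act τ (column code j) i ⟩
  lookup (column code j) (τ ⟨$⟩ˡ i) ≡⟨ lookup∘tabulate (λ x → code x j) (τ ⟨$⟩ˡ i) ⟩
  code (τ ⟨$⟩ˡ i) j                 ∎
  where open ≡-Reasoning

module OrbitCode {n m o s} (P : Fin m → Colour n) (orbit : OrbitSize P o)
                 (w : Fin s → Word n) (colour : Fin s → Fin m) (w∈ : ∀ j → w j ∈C P (colour j)) where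

  private
    g : Fin o → Sym n
    g = proj₁ orbit

    rep : Sym n → Fin o
    rep σ = proj₁ (proj₂ (proj₂ orbit) σ)

    act-rep : ∀ σ → SameTuple (actTuple σ P) (actTuple (g (rep σ)) P)
    act-rep σ = proj₂ (proj₂ (proj₂ orbit) σ)

  orbitCode : Sym n → Fin o × Vec (Word n) s
  orbitCode σ = rep σ , tabulate (λ j → act (flip (g (rep σ))) (act σ (w j)))

  private
    decode : Fin o × Vec (Word n) s → Fin s → Word n
    decode (a , us) j = act (g a) (lookup us j)

    decode-orbitCode : ∀ σ j → decode (orbitCode σ) j ≡ act σ (w j)
    decode-orbitCode σ j = trans (cong (act (g (rep σ))) (lookup∘tabulate _ j)) (act-act-flip (g (rep σ)) _)

  orbitCode-injective : ∀ {σ τ} → orbitCode σ ≡ orbitCode τ → ∀ j → act σ (w j) ≡ act τ (w j)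
  orbitCode-injective {σ} {τ} eq j = begin
    act σ (w j)              ≡⟨ decode-orbitCode σ j ⟨
    decode (orbitCode σ) j   ≡⟨ cong (λ c → decode c j) eq ⟩
    decode (orbitCode τ) j   ≡⟨ decode-orbitCode τ j ⟩
    act τ (w j)              ∎
    where open ≡-Reasoning

  orbitCode∈ : ∀ σ → orbitCode σ ∈ cartesianProduct (allFin o) (choices (members ∘ P ∘ colour))
  orbitCode∈ σ = ∈-cartesianProduct⁺ (∈-allFin (rep σ)) (∈-choices _ λ j →
    subst (_∈ members (P (colour j))) (sym (lookup∘tabulate _ j)) (∈-members (P (colour j)) (begin
      P (colour j) (act (flip (g (rep σ))) (act σ (w j))) ≡⟨ act-rep σ (colour j) (act σ (w j)) ⟨
      actSet σ (P (colour j)) (act σ (w j))              ≡⟨ actSet-act σ (P (colour j)) (w j) ⟩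
      P (colour j) (w j)                                 ≡⟨ w∈ j ⟩
      true                                               ∎)))
    where open ≡-Reasoning

n!≤orbitSize*B^s : ∀ {n m s B o} (P : Fin m → Colour n) → n ≤ 2 ^ s →
  (∀ v → ∃ λ i → v ∈C P i) → (∀ i → card (P i) ≤ B) → OrbitSize P o → n ! ≤ o * B ^ s
n!≤orbitSize*B^s {n} {m} {s} {B} {o} P n≤2^s covers small orbit = begin
  n !                                     ≡⟨ length-perms n ⟨
  length (perms n)                        ≡⟨ length-map orbitCode (perms n) ⟨
  length (map orbitCode (perms n))        ≤⟨ Unique-⊆⇒length≤ codes-unique codes⊆ ⟩
  length (cartesianProduct (allFin o) Ws) ≡⟨ length-cartesianProductWith _,_ (allFin o) Ws ⟩
  length (allFin o) * length Ws           ≡⟨ cong (_* length Ws) (length-tabulate {n = o} (λ a → a)) ⟩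
  o * length Ws                           ≤⟨ *-monoʳ-≤ o (length-choices≤ (members ∘ P ∘ colour) members≤B) ⟩
  o * B ^ s                               ∎
  where
  open ≤-Reasoning
  w : Fin s → Word n
  w = column (binaryCode n≤2^s)
  colour : Fin s → Fin m
  colour j = proj₁ (covers (w j))
  open OrbitCode P orbit w colour (λ j → proj₂ (covers (w j)))
  Ws : List (Vec (Word n) s)
  Ws = choices (members ∘ P ∘ colour)
  members≤B : ∀ j → length (members (P (colour j))) ≤ B
  members≤B j = ≤-trans (≤-reflexive (length-members (P (colour j)))) (small (colour j))
  codes-unique : Unique (map orbitCode (perms n))
  codes-unique = SetoidUnique.map⁺ (≈-setoid n) (setoid _)
    (λ {σ} {τ} eq → act-columns-injective _ (binaryCode-injective n≤2^s) {σ} {τ} (orbitCode-injective eq))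
    (perms-unique n)
  codes⊆ : map orbitCode (perms n) ⊆ cartesianProduct (allFin o) Ws
  codes⊆ c∈ with σ , _ , refl ← ∈-map⁻ orbitCode c∈ = orbitCode∈ σ

n<2^n : ∀ n → n < 2 ^ n
n<2^n zero    = s≤s z≤n
n<2^n (suc n) = +-mono-≤ (m^n>0 2 n) (≤-trans (n<2^n n) (m≤m+n (2 ^ n) 0))

2^-cancel-≤ : ∀ {m n} → 2 ^ m ≤ 2 ^ n → m ≤ n
2^-cancel-≤ {m} {n} le = subst₂ _≤_ (⌊log₂[2^n]⌋≡n m) (⌊log₂[2^n]⌋≡n n) (⌊log₂⌋-mono-≤ le)

2^-bracket : ∀ n .{{_ : NonZero n}} → ∃ λ s → n ≤ 2 ^ s × 2 ^ s < 2 * n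
2^-bracket 1 = 0 , ≤-refl , ≤-refl
2^-bracket (suc (suc n)) with 2^-bracket (suc n)
... | s , 1+n≤2^s , 2^s<2+2n with suc (suc n) ≤? 2 ^ s
...   | yes 2+n≤2^s = s , 2+n≤2^s , <-≤-trans 2^s<2+2n (*-monoʳ-≤ 2 (n≤1+n (suc n)))
...   | no  2+n≰2^s = suc s , +-mono-≤ (m^n>0 2 s) (≤-trans 1+n≤2^s (m≤m+n (2 ^ s) 0))
                            , *-monoʳ-< 2 (≰⇒> 2+n≰2^s)

m^n≤n!*m^m : ∀ m .{{_ : NonZero m}} n → m ^ n ≤ n ! * m ^ m
m^n≤n!*m^m m zero    = +-monoˡ-≤ 0 (m^n>0 m m)
m^n≤n!*m^m m (suc n) with m ≤? suc n
... | yes m≤1+n = begin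
  m * m ^ n               ≤⟨ *-mono-≤ m≤1+n (m^n≤n!*m^m m n) ⟩
  suc n * (n ! * m ^ m)   ≡⟨ *-assoc (suc n) (n !) (m ^ m) ⟨
  suc n ! * m ^ m         ∎
  where open ≤-Reasoning
... | no m≰1+n = begin
  m ^ suc n               ≤⟨ ^-monoʳ-≤ m (<⇒≤ (≰⇒> m≰1+n)) ⟩
  m ^ m                   ≤⟨ m≤n*m (m ^ m) (suc n !) {{suc n !≢0}} ⟩
  suc n ! * m ^ m         ∎
  where open ≤-Reasoning

[4+t]²≤2*[3+t]² : ∀ t → (4 + t) * (4 + t) ≤ 2 * ((3 + t) * (3 + t))
[4+t]²≤2*[3+t]² t = ≤-trans (m≤m+n ((4 + t) * (4 + t)) (2 + 4 * t + t * t)) (≤-reflexive (expand t))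
  where
  expand : ∀ t → (4 + t) * (4 + t) + (2 + 4 * t + t * t) ≡ 2 * ((3 + t) * (3 + t))
  expand = solve-∀

[4+t]²≤2^[4+t] : ∀ t → (4 + t) * (4 + t) ≤ 2 ^ (4 + t)
[4+t]²≤2^[4+t] zero    = ≤-refl
[4+t]²≤2^[4+t] (suc t) = ≤-trans ([4+t]²≤2*[3+t]² (suc t)) (*-monoʳ-≤ 2 ([4+t]²≤2^[4+t] t))

D+[a+s]*s≤[D+a+1]*s² : ∀ D a s .{{_ : NonZero s}} → D + (a + s) * s ≤ (D + a + 1) * (s * s)
D+[a+s]*s≤[D+a+1]*s² D a (suc t) =
  ≤-trans (m≤m+n _ (D * (t + t + t * t) + a * (1 + t) * t)) (≤-reflexive (expand D a t))
  where
  expand : ∀ D a t → D + (a + (1 + t)) * (1 + t) + (D * (t + t + t * t) + a * (1 + t) * t)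
                   ≡ (D + a + 1) * ((1 + t) * (1 + t))
  expand = solve-∀

K*s²≤2^s : ∀ K s → 4 * K + (4 + 4 * K) ≤ s → K * (s * s) ≤ 2 ^ s
K*s²≤2^s K s S≤s with t , refl ← m≤n⇒∃[o]m+o≡n S≤s = begin
  K * (s * s)              ≤⟨ *-monoʳ-≤ K (*-mono-≤ s≤2u s≤2u) ⟩
  K * ((2 * u) * (2 * u))  ≡⟨ regroup K u ⟩
  4 * K * (u * u)          ≤⟨ *-mono-≤ (<⇒≤ (n<2^n (4 * K))) ([4+t]²≤2^[4+t] (4 * K + t)) ⟩
  2 ^ (4 * K) * 2 ^ u      ≡⟨ ^-distribˡ-+-* 2 (4 * K) u ⟨
  2 ^ (4 * K + u)          ≡⟨ cong (2 ^_) s≡4K+u ⟨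
  2 ^ s                    ∎
  where
  open ≤-Reasoning
  u : ℕ
  u = 4 + 4 * K + t
  s≡4K+u : s ≡ 4 * K + u
  s≡4K+u = +-assoc (4 * K) (4 + 4 * K) t
  s≤2u : s ≤ 2 * u
  s≤2u = ≤-trans (≤-reflexive s≡4K+u) (+-mono-≤ (≤-trans (m≤m+n (4 * K) t) (m≤n+m _ 4)) (m≤m+n u 0))
  regroup : ∀ K u → K * ((2 * u) * (2 * u)) ≡ 4 * K * (u * u)
  regroup = solve-∀

D+[a+s]*s≤2^s : ∀ D a → ∃ λ S → ∀ {s} → S ≤ s → D + (a + s) * s ≤ 2 ^ s
D+[a+s]*s≤2^s D a = S , λ {s} S≤s → begin
  D + (a + s) * s  ≤⟨ D+[a+s]*s≤[D+a+1]*s² D a s {{>-nonZero (≤-trans (s≤s z≤n) (≤-trans (m≤n+m (4 + 4 * K) (4 * K)) S≤s))}} ⟩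
  K * (s * s)      ≤⟨ K*s²≤2^s K s S≤s ⟩
  2 ^ s            ∎
  where
  open ≤-Reasoning
  K S : ℕ
  K = D + a + 1
  S = 4 * K + (4 + 4 * K)

[c*n]^s≤2^[[a+s]*s] : ∀ a s {c n} → c ≤ 2 ^ a → n ≤ 2 ^ s → (c * n) ^ s ≤ 2 ^ ((a + s) * s)
[c*n]^s≤2^[[a+s]*s] a s {c} {n} c≤2^a n≤2^s = begin
  (c * n) ^ s          ≤⟨ ^-monoˡ-≤ s (*-mono-≤ c≤2^a n≤2^s) ⟩
  (2 ^ a * 2 ^ s) ^ s  ≡⟨ cong (_^ s) (^-distribˡ-+-* 2 a s) ⟨
  (2 ^ (a + s)) ^ s    ≡⟨ ^-*-assoc 2 (a + s) s ⟩
  2 ^ ((a + s) * s)    ∎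
  where open ≤-Reasoning

2^-distrib-+₄ : ∀ w x y z → 2 ^ w * 2 ^ x * 2 ^ y * 2 ^ z ≡ 2 ^ (w + x + y + z)
2^-distrib-+₄ w x y z = begin
  2 ^ w * 2 ^ x * 2 ^ y * 2 ^ z  ≡⟨ cong (λ p → p * 2 ^ y * 2 ^ z) (^-distribˡ-+-* 2 w x) ⟨
  2 ^ (w + x) * 2 ^ y * 2 ^ z    ≡⟨ cong (_* 2 ^ z) (^-distribˡ-+-* 2 (w + x) y) ⟨
  2 ^ (w + x + y) * 2 ^ z        ≡⟨ ^-distribˡ-+-* 2 (w + x + y) z ⟨
  2 ^ (w + x + y + z)            ∎
  where open ≡-Reasoning

-- With K = 2^(e+2), n! ≥ K^n / K^K exceeds c' · 2^{ne} · (cn)^s ≤ 2^{ne + O(s²)} by 2^{2n - O(s²)},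
-- and 2n > 2^s dominates O(s²) once s ≥ S.
superpolynomial : ∀ e a → ∃ λ S → ∀ {n s o c c'} → c ≤ 2 ^ a → c' ≤ 2 ^ a →
  S ≤ s → n ≤ 2 ^ s → 2 ^ s < 2 * n → n ! ≤ o * (c * n) ^ s → c' * (2 ^ n) ^ e < o
superpolynomial e a = S , bound
  where
  K D S : ℕ
  K = 2 ^ (e + 2)
  D = a + (e + 2) * K
  S = proj₁ (D+[a+s]*s≤2^s D a)
  bound : ∀ {n s o c c'} → c ≤ 2 ^ a → c' ≤ 2 ^ a →
    S ≤ s → n ≤ 2 ^ s → 2 ^ s < 2 * n → n ! ≤ o * (c * n) ^ s → c' * (2 ^ n) ^ e < o
  bound {n} {s} {o} {c} {c'} c≤2^a c'≤2^a S≤s n≤2^s 2^s<2n count = ≰⇒> λ o≤c'*[2^n]^e →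
    <⇒≱ 2^s<2n (≤-trans (2n≤D+[a+s]*s o≤c'*[2^n]^e) (proj₂ (D+[a+s]*s≤2^s D a) S≤s))
    where
    2n≤D+[a+s]*s : o ≤ c' * (2 ^ n) ^ e → 2 * n ≤ D + (a + s) * s
    2n≤D+[a+s]*s o≤ = +-cancelˡ-≤ (n * e) _ _ (subst₂ _≤_ (lhs e n) (rhs a n e s K) (2^-cancel-≤ (begin
      2 ^ ((e + 2) * n)                                           ≡⟨ ^-*-assoc 2 (e + 2) n ⟨
      K ^ n                                                       ≤⟨ m^n≤n!*m^m K {{m^n≢0 2 (e + 2)}} n ⟩
      n ! * K ^ K                                                 ≤⟨ *-monoˡ-≤ (K ^ K) count ⟩
      o * (c * n) ^ s * K ^ K
        ≤⟨ *-monoˡ-≤ (K ^ K) (*-mono-≤ (≤-trans o≤ (*-mono-≤ c'≤2^a (≤-reflexive (^-*-assoc 2 n e))))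
                                         ([c*n]^s≤2^[[a+s]*s] a s c≤2^a n≤2^s)) ⟩
      2 ^ a * 2 ^ (n * e) * 2 ^ ((a + s) * s) * K ^ K
        ≡⟨ cong (2 ^ a * 2 ^ (n * e) * 2 ^ ((a + s) * s) *_) (^-*-assoc 2 (e + 2) K) ⟩
      2 ^ a * 2 ^ (n * e) * 2 ^ ((a + s) * s) * 2 ^ ((e + 2) * K)
        ≡⟨ 2^-distrib-+₄ a (n * e) ((a + s) * s) ((e + 2) * K) ⟩
      2 ^ (a + n * e + (a + s) * s + (e + 2) * K)                 ∎)))
      where
      open ≤-Reasoning
      lhs : ∀ e n → (e + 2) * n ≡ n * e + 2 * n
      lhs = solve-∀
      rhs : ∀ a n e s K → a + n * e + (a + s) * s + (e + 2) * K ≡ n * e + (a + (e + 2) * K + (a + s) * s)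
      rhs = solve-∀

lemma16 : (m : ℕ → ℕ) (P : (n : ℕ) → Fin (m n) → Colour n) (b : (n : ℕ) → Fin (m n))
    → (∀ n → IsOrderedPartition (P n))
    → (∀ n k k' (i : Fin (m n)) → SPSize (P n i) k → SPSize (P n (b n)) k' → k ≤ k')
    → (∀ n (v : Word n) → ∃ λ (i : Fin (m n)) → v ∈C P n i)
    → (∃ λ (c : ℕ) → ∃ λ (N : ℕ) → ∀ n → N ≤ n → ∀ (i : Fin (m n)) → card (P n i) ≤ c * n)
    → (∀ (d : ℕ) → ∃ λ (N : ℕ) → ∀ n → N ≤ n → ∀ k → SPSize (P n (b n)) k → d * k ≤ n)
    → ∀ (e c : ℕ) → ∃ λ (N : ℕ) → ∀ n → N ≤ n → ∀ o → OrbitSize (P n) o → c * (2 ^ n) ^ e < o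
lemma16 m P b _ _ covers (c , N₀ , small) _ e c' = N₀ + suc (2 ^ S) , bound
  where
  a S : ℕ
  a = c + c'
  S = proj₁ (superpolynomial e a)
  c≤2^a : c ≤ 2 ^ a
  c≤2^a = ≤-trans (m≤m+n c c') (<⇒≤ (n<2^n a))
  c'≤2^a : c' ≤ 2 ^ a
  c'≤2^a = ≤-trans (m≤n+m c' c) (<⇒≤ (n<2^n a))
  2^S<n : ∀ {n} → N₀ + suc (2 ^ S) ≤ n → 2 ^ S < n
  2^S<n N≤n = ≤-trans (m≤n+m _ N₀) N≤n
  bound : ∀ n → N₀ + suc (2 ^ S) ≤ n → ∀ o → OrbitSize (P n) o → c' * (2 ^ n) ^ e < o
  bound n N≤n o orbit with s , n≤2^s , 2^s<2n ← 2^-bracket n {{>-nonZero (≤-trans (s≤s z≤n) (2^S<n N≤n))}} =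
    proj₂ (superpolynomial e a) {s = s} c≤2^a c'≤2^a S≤s n≤2^s 2^s<2n
      (n!≤orbitSize*B^s {s = s} (P n) n≤2^s (covers n) (small n (≤-trans (m≤m+n N₀ _) N≤n)) orbit)
    where
    S≤s : S ≤ s
    S≤s = 2^-cancel-≤ (<⇒≤ (<-≤-trans (2^S<n N≤n) n≤2^s))
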